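{- Let $D$ be a finite $m$-colored digraph without loops and without isolated vertices in which every chromatic class is transitive. If the color-class digraph $\mathscr{C}_C(D)$ has no directed cycles of length at least two, then $D$ has a kernel by rainbow paths.
   Context: An $m$-colored digraph has its arcs colored with $m$ colors. A chromatic class is the set of arcs of one color; it is transitive if the subdigraph formed by its arcs is a transitive digraph. The color-class digraph $\mathscr{C}_C(D)$ has as vertices the colors appearing on arcs of $D$, with $(i,j)$ an arc (loops allowed) iff there are arcs $(u,v),(v,w)$ in $D$ colored $i$ and $j$ respectively. A path (directed, with distinct vertices) is rainbow if all its arcs have distinct colors. A kernel by rainbow paths is a set $N\subseteq V(D)$ such that there is no rainbow path between two distinct vertices of $N$, and for every $x\in V(D)\setminus N$ there is a rainbow path from $x$ to some vertex of $N$. -}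

module Defs where

open import Data.Nat using (ℕ; _≥_)
open import Data.Fin using (Fin)
open import Data.Fin.Subset using (Subset; _∈_; _∉_)
open import Data.Maybe using (Maybe; just; nothing)
open import Data.List using (List; []; _∷_; length)
open import Data.List.Relation.Unary.Unique.Propositional using (Unique)
open import Data.Product using (Σ; ∃; ∃-syntax; _×_)
open import Data.Sum using (_⊎_)
open import Relation.Binary.PropositionalEquality using (_≡_; _≢_)
open import Relation.Nullary using (¬_)

-- A finite m-coloured digraph on the vertex set Fin n.
-- col u v ≡ nothing : no arc from u to v;  col u v ≡ just i : arc (u,v) of colour i.
record ColDigraph (n m : ℕ) : Set where
  field
    col : Fin n → Fin n → Maybe (Fin m)
open ColDigraph public

module _ {n m : ℕ} (D : ColDigraph n m) where

  Arc : Fin n → Fin n → Set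
  Arc u v = ∃[ i ] col D u v ≡ just i

  Loopless : Set
  Loopless = ∀ v → col D v v ≡ nothing

  NoIsolated : Set
  NoIsolated = ∀ v → ∃[ u ] (Arc v u ⊎ Arc u v)

  TransitiveClass : Fin m → Set
  TransitiveClass i = ∀ u v w → col D u v ≡ just i → col D v w ≡ just i →
                      u ≢ w → col D u w ≡ just i

  AllClassesTransitive : Set
  AllClassesTransitive = ∀ i → TransitiveClass i

  data Walk : Fin n → Fin n → List (Fin n) → List (Fin m) → Set where
    nil  : ∀ {u} → Walk u u (u ∷ []) []
    cons : ∀ {u v w i vs cs} → col D u v ≡ just i → Walk v w vs cs →
           Walk u w (u ∷ vs) (i ∷ cs)

  RainbowPath : Fin n → Fin n → Set
  RainbowPath x y = ∃[ vs ] ∃[ cs ] (Walk x y vs cs × Unique vs × Unique cs)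

  KernelByRainbowPaths : Subset n → Set
  KernelByRainbowPaths N =
    (∀ x y → x ∈ N → y ∈ N → x ≢ y → ¬ RainbowPath x y) ×
    (∀ x → x ∉ N → ∃[ y ] (y ∈ N × RainbowPath x y))

  CArc : Fin m → Fin m → Set
  CArc i j = ∃[ u ] ∃[ v ] ∃[ w ] (col D u v ≡ just i × col D v w ≡ just j)

  data CWalk : Fin m → Fin m → List (Fin m) → Set where
    cnil  : ∀ {i} → CWalk i i (i ∷ [])
    ccons : ∀ {i j k is} → CArc i j → CWalk j k is → CWalk i k (i ∷ is)

  CCycleLen≥2 : Set
  CCycleLen≥2 = ∃[ i ] ∃[ j ] ∃[ is ] (CWalk i j is × Unique is × length is ≥ 2 × CArc j i)

-- Under the two hypotheses every walk can be straightened into a rainbow path with the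
-- same ends: when an arc u → v is put in front of a rainbow path from v whose colours
-- already contain the colour i of that arc, either the next arc also has colour i, and
-- transitivity of that class lets us skip over v, or i reappears later, and the colours
-- met in between close a cycle of length at least two in the colour-class digraph.
-- Hence "there is a rainbow path from x to y" is just reachability, a decidable preorder
-- on the vertices, and the maximal elements of a finite preorder, one per terminal
-- strong component, form a kernel of it.
module Submission where

open import Defs
open import Level using (Level)
open import Data.Nat using (ℕ; zero; suc; _≤_; _<_; _≮_; _<?_; z≤n; s≤s)
open import Data.Nat.Properties using (<-irrefl; <-trans; ≮⇒≥; ≤∧≮⇒≡)
open import Data.Fin using (Fin; toℕ; _≟_)
open import Data.Fin.Properties using (any?; all?; toℕ-injective; injective⇒≤)
open import Data.Fin.Induction using (spo-noetherian)
open import Data.Fin.Subset using (Subset) renaming (_∈_ to _∈ₛ_)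
open import Data.Vec using (tabulate)
open import Data.Vec.Properties using ([]=⇒lookup; lookup⇒[]=; lookup∘tabulate)
open import Data.Maybe using (just; nothing)
open import Data.Bool using (true)
open import Data.List using (List; []; _∷_; _++_; length; lookup)
open import Data.List.Relation.Unary.All as All using ([]; _∷_)
open import Data.List.Relation.Unary.All.Properties using (¬Any⇒All¬; ++⁻)
open import Data.List.Relation.Unary.Any using (here; there)
import Data.List.Relation.Unary.Any as Any
open import Data.List.Relation.Unary.AllPairs using ([]; _∷_)
open import Data.List.Membership.Propositional using (_∈_; _∉_)
open import Data.List.Membership.Propositional.Properties using (∈-lookup)
open import Data.List.Relation.Unary.Unique.Propositional using (Unique)
open import Data.Product using (∃-syntax; _×_; _,_)
open import Data.Sum using (_⊎_; inj₁; inj₂)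
open import Data.Empty using (⊥-elim)
open import Function using (_∘_; flip)
open import Function.Definitions using (Injective)
open import Induction.WellFounded using (Acc; acc)
open import Relation.Binary using (Rel; Reflexive; Transitive; Decidable; IsStrictPartialOrder)
open import Relation.Binary.PropositionalEquality
  using (_≡_; _≢_; refl; sym; trans; cong; isEquivalence; resp₂; ≢-sym)
open import Relation.Unary using (Pred) renaming (Decidable to Decidableᵘ)
open import Relation.Nullary using (¬_; yes; no; does; contradiction; ¬?)
open import Relation.Nullary.Decidable using (map′; dec-true; dec-false; decidable-stable; _×-dec_; _⊎-dec_; _→-dec_)

private
  variable
    ℓ : Level
    A : Set

lookup-injective : {xs : List A} → Unique xs → Injective _≡_ _≡_ (lookup xs)
lookup-injective (_ ∷ _)    {Fin.zero}  {Fin.zero}  _  = refl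
lookup-injective (x∉xs ∷ _) {Fin.zero}  {Fin.suc j} eq = contradiction eq (All.lookup x∉xs (∈-lookup j))
lookup-injective (x∉xs ∷ _) {Fin.suc i} {Fin.zero}  eq = contradiction (sym eq) (All.lookup x∉xs (∈-lookup i))
lookup-injective (_ ∷ u)    {Fin.suc i} {Fin.suc j} eq = cong Fin.suc (lookup-injective u eq)

Unique⇒length≤ : ∀ {n} {xs : List (Fin n)} → Unique xs → length xs ≤ n
Unique⇒length≤ u = injective⇒≤ (lookup-injective u)

Unique[xs++y∷ys]⇒Unique[y∷xs] : ∀ (xs : List A) {y ys} → Unique (xs ++ y ∷ ys) → Unique (y ∷ xs)
Unique[xs++y∷ys]⇒Unique[y∷xs] []       _            = [] ∷ []
Unique[xs++y∷ys]⇒Unique[y∷xs] (x ∷ xs) (x∉ ∷ u) with Unique[xs++y∷ys]⇒Unique[y∷xs] xs u | ++⁻ xs x∉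
... | y∉xs ∷ uxs | x∉xs , x≢y ∷ _ = (≢-sym x≢y ∷ y∉xs) ∷ x∉xs ∷ uxs

module _ {n} {P : Pred (Fin n) ℓ} (P? : Decidableᵘ P) where

  fromDec : Subset n
  fromDec = tabulate (does ∘ P?)

  ∈-fromDec⁺ : ∀ {x} → P x → x ∈ₛ fromDec
  ∈-fromDec⁺ {x} px = lookup⇒[]= x fromDec (trans (lookup∘tabulate (does ∘ P?) x) (dec-true (P? x) px))

  ∈-fromDec⁻ : ∀ {x} → x ∈ₛ fromDec → P x
  ∈-fromDec⁻ {x} x∈ = decidable-stable (P? x) λ ¬px →
    contradiction (trans (sym (dec-false (P? x) ¬px)) does≡true) λ ()
    where
    does≡true : does (P? x) ≡ true
    does≡true = trans (sym (lookup∘tabulate (does ∘ P?) x)) ([]=⇒lookup x∈)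

module FinitePreorder {n} {_≲_ : Rel (Fin n) ℓ}
  (≲-refl : Reflexive _≲_) (≲-trans : Transitive _≲_) (_≲?_ : Decidable _≲_) where

  -- Strict part of the preorder, with ties inside a strong component broken towards
  -- the smaller index, so that every strong component has a single maximal element.
  _⊏_ : Rel (Fin n) ℓ
  x ⊏ y = x ≲ y × (y ≲ x → toℕ y < toℕ x)

  _⊏?_ : Decidable _⊏_
  x ⊏? y = (x ≲? y) ×-dec ((y ≲? x) →-dec (toℕ y <? toℕ x))

  ⊏-isStrictPartialOrder : IsStrictPartialOrder _≡_ _⊏_
  ⊏-isStrictPartialOrder = record
    { isEquivalence = isEquivalence
    ; irrefl        = λ { refl (x≲x , x<x) → <-irrefl refl (x<x x≲x) }
    ; trans         = λ (x≲y , y<x) (y≲z , z<y) →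
        ≲-trans x≲y y≲z ,
        λ z≲x → <-trans (z<y (≲-trans z≲x x≲y)) (y<x (≲-trans y≲z z≲x))
    ; <-resp-≈      = resp₂ _⊏_
    }

  Maximal : Pred (Fin n) ℓ
  Maximal x = ∀ y → ¬ x ⊏ y

  maximal? : Decidableᵘ Maximal
  maximal? x = all? (λ y → ¬? (x ⊏? y))

  ≲-maximal : ∀ x → ∃[ y ] (x ≲ y × Maximal y)
  ≲-maximal x = go (spo-noetherian ⊏-isStrictPartialOrder x)
    where
    go : ∀ {x} → Acc (flip _⊏_) x → ∃[ y ] (x ≲ y × Maximal y)
    go {x} (acc rec) with any? (x ⊏?_)
    ... | yes (y , x⊏y@(x≲y , _)) = let (z , y≲z , z-max) = go (rec x⊏y) in z , ≲-trans x≲y y≲z , z-max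
    ... | no ∄y                   = x , ≲-refl , λ y x⊏y → ∄y (y , x⊏y)

  maximal-≲ : ∀ {x y} → Maximal x → x ≲ y → y ≲ x × toℕ y ≮ toℕ x
  maximal-≲ {x} {y} x-max x≲y with y ≲? x
  ... | yes y≲x = y≲x , λ y<x → x-max y (x≲y , λ _ → y<x)
  ... | no  y≴x = ⊥-elim (x-max y (x≲y , λ y≲x → contradiction y≲x y≴x))

  maximal-antisym : ∀ {x y} → Maximal x → Maximal y → x ≲ y → x ≡ y
  maximal-antisym x-max y-max x≲y =
    let (y≲x , y≮x) = maximal-≲ x-max x≲y
        (_   , x≮y) = maximal-≲ y-max y≲x
    in toℕ-injective (≤∧≮⇒≡ (≮⇒≥ y≮x) x≮y)

  kernel : ∃[ N ] ((∀ {x y} → x ∈ₛ N → y ∈ₛ N → x ≲ y → x ≡ y) × (∀ x → ∃[ y ] (y ∈ₛ N × x ≲ y)))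
  kernel = fromDec maximal? ,
    (λ x∈ y∈ → maximal-antisym (∈-fromDec⁻ maximal? x∈) (∈-fromDec⁻ maximal? y∈)) ,
    λ x → let (y , x≲y , y-max) = ≲-maximal x in y , ∈-fromDec⁺ maximal? y-max , x≲y

module _ {n m} (D : ColDigraph n m) where

  Reachable : Fin n → Fin n → Set
  Reachable x y = ∃[ vs ] ∃[ cs ] Walk D x y vs cs

  ReachableIn : ℕ → Fin n → Fin n → Set
  ReachableIn zero    x y = x ≡ y
  ReachableIn (suc k) x y = x ≡ y ⊎ ∃[ v ] (Arc D x v × ReachableIn k v y)

  arc? : Decidable (Arc D)
  arc? x v with col D x v
  ... | just i  = yes (i , refl)
  ... | nothing = no λ ()

  reachableIn? : ∀ k → Decidable (ReachableIn k)
  reachableIn? zero    x y = x ≟ y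
  reachableIn? (suc k) x y = (x ≟ y) ⊎-dec any? (λ v → arc? x v ×-dec reachableIn? k v y)

  reachableIn⇒reachable : ∀ k {x y} → ReachableIn k x y → Reachable x y
  reachableIn⇒reachable zero    refl       = _ , _ , nil
  reachableIn⇒reachable (suc k) (inj₁ refl) = _ , _ , nil
  reachableIn⇒reachable (suc k) (inj₂ (_ , (_ , e) , r)) =
    let (_ , _ , W) = reachableIn⇒reachable k r in _ , _ , cons e W

  walk⇒reachableIn : ∀ {k x y vs cs} → Walk D x y vs cs → length cs ≤ k → ReachableIn k x y
  walk⇒reachableIn {zero}  nil        _       = refl
  walk⇒reachableIn {suc k} nil        _       = inj₁ refl
  walk⇒reachableIn {suc k} (cons e W) (s≤s l) = inj₂ (_ , (_ , e) , walk⇒reachableIn W l)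

  walk-++ : ∀ {x y z vs cs vs′ cs′} → Walk D x y vs cs → Walk D y z vs′ cs′ → Reachable x z
  walk-++ nil        Q = _ , _ , Q
  walk-++ (cons e P) Q = let (_ , _ , W) = walk-++ P Q in _ , _ , cons e W

  source∈vertices : ∀ {x y vs cs} → Walk D x y vs cs → x ∈ vs
  source∈vertices nil        = here refl
  source∈vertices (cons _ _) = here refl

  rainbowPath-refl : Reflexive (RainbowPath D)
  rainbowPath-refl = _ , _ , nil , [] ∷ [] , []

  rainbowPath-suffix : ∀ {u x w vs cs} → Walk D x w vs cs → Unique vs → Unique cs → u ∈ vs →
                       RainbowPath D u w
  rainbowPath-suffix P@nil        uvs       ucs       (here refl) = _ , _ , P , uvs , ucs
  rainbowPath-suffix P@(cons _ _) uvs       ucs       (here refl) = _ , _ , P , uvs , ucs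
  rainbowPath-suffix nil          _         _         (there ())
  rainbowPath-suffix (cons _ P)   (_ ∷ uvs) (_ ∷ ucs) (there u∈)  = rainbowPath-suffix P uvs ucs u∈

  colourWalkTo : ∀ {v w vs c cs i} → Walk D v w vs (c ∷ cs) → i ∈ cs →
                 ∃[ j ] ∃[ js ] ∃[ rest ] (cs ≡ js ++ i ∷ rest × CWalk D c j (c ∷ js) × CArc D j i)
  colourWalkTo (cons e (cons e′ _)) (here refl) = _ , [] , _ , refl , cnil , (_ , _ , _ , e , e′)
  colourWalkTo (cons e (cons e′ W)) (there i∈) with colourWalkTo (cons e′ W) i∈
  ... | j , js , rest , refl , cw , ji = j , _ ∷ js , rest , refl , ccons (_ , _ , _ , e , e′) cw , ji

  -- The colours from c up to the next occurrence of i, preceded by i, form the cycle.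
  colourCycle : ∀ {u v w vs c cs i} → col D u v ≡ just i → Walk D v w vs (c ∷ cs) →
                Unique (c ∷ cs) → i ∈ cs → CCycleLen≥2 D
  colourCycle e P@(cons e′ _) ucs i∈ with colourWalkTo P i∈
  ... | j , js , _ , refl , cw , ji =
    _ , j , _ , ccons (_ , _ , _ , e , e′) cw , Unique[xs++y∷ys]⇒Unique[y∷xs] (_ ∷ js) ucs , s≤s (s≤s z≤n) , ji

  module _ (transitive : AllClassesTransitive D) (acyclic : ¬ CCycleLen≥2 D) where

    prependArc : ∀ {u v w i vs cs} → col D u v ≡ just i → Walk D v w vs cs →
                 Unique vs → Unique cs → u ∉ vs → RainbowPath D u w
    prependArc e nil _ _ u∉ = _ , _ , cons e nil , ¬Any⇒All¬ _ u∉ ∷ [] ∷ [] , [] ∷ []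
    prependArc {u} {i = i} e P@(cons {i = c} {cs = cs} e′ P′) uvs@(_ ∷ uvs′) ucs u∉
      with i ≟ c | Any.any? (i ≟_) cs
    ... | yes refl | _ =
      _ , _ , cons (transitive i _ _ _ e e′ u≢next) P′ , ¬Any⇒All¬ _ (u∉ ∘ there) ∷ uvs′ , ucs
      where
      u≢next : u ≢ _
      u≢next refl = u∉ (there (source∈vertices P′))
    ... | no _ | yes i∈ = ⊥-elim (acyclic (colourCycle e P ucs i∈))
    ... | no i≢c | no i∉ =
      _ , _ , cons e P , ¬Any⇒All¬ _ u∉ ∷ uvs , (i≢c ∷ ¬Any⇒All¬ _ i∉) ∷ ucs

    walk⇒rainbowPath : ∀ {x y vs cs} → Walk D x y vs cs → RainbowPath D x y
    walk⇒rainbowPath nil = rainbowPath-refl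
    walk⇒rainbowPath (cons {u = u} e W) with walk⇒rainbowPath W
    ... | vs , _ , P , uvs , ucs with Any.any? (u ≟_) vs
    ...   | yes u∈ = rainbowPath-suffix P uvs ucs u∈
    ...   | no  u∉ = prependArc e P uvs ucs u∉

    reachable⇒rainbowPath : ∀ {x y} → Reachable x y → RainbowPath D x y
    reachable⇒rainbowPath (_ , _ , W) = walk⇒rainbowPath W

    rainbowPath-trans : Transitive (RainbowPath D)
    rainbowPath-trans (_ , _ , P , _) (_ , _ , Q , _) = reachable⇒rainbowPath (walk-++ P Q)

    -- A rainbow path uses at most m colours, so searching walks of length ≤ m suffices.
    rainbowPath? : Decidable (RainbowPath D)
    rainbowPath? x y = map′ (reachable⇒rainbowPath ∘ reachableIn⇒reachable m)
      (λ (_ , _ , P , _ , ucs) → walk⇒reachableIn P (Unique⇒length≤ ucs))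
      (reachableIn? m x y)

mainTheorem14 : {n m : ℕ} (D : ColDigraph n m) → Loopless D → NoIsolated D →
                AllClassesTransitive D → ¬ CCycleLen≥2 D →
                ∃[ N ] KernelByRainbowPaths D N
mainTheorem14 D _ _ transitive acyclic =
  let open FinitePreorder (rainbowPath-refl D) (rainbowPath-trans D transitive acyclic)
                          (rainbowPath? D transitive acyclic)
      (N , independent , absorbing) = kernel
  in N , (λ _ _ x∈ y∈ x≢y path → x≢y (independent x∈ y∈ path)) , λ x _ → absorbing x
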